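{- Let $n$ be a positive integer divisible by at least two distinct primes, and let $C_n$ be the cyclic group of order $n$. Let $X$ be a subset of $C_n$ of minimum possible size with the property that the induced subgraph of the power graph $\mathcal{P}(C_n)$ on $C_n\setminus X$ is disconnected. Then for each positive divisor $d$ of $n$, either $E_d\subseteq X$ or $E_d\cap X=\emptyset$.
   Context: The power graph $\mathcal{P}(C_n)$ is the simple undirected graph with vertex set $C_n$ in which two distinct vertices are adjacent if and only if one of them is a power of the other. For a positive divisor $d$ of $n$, $E_d$ denotes the set of all elements of $C_n$ of order exactly $d$. -}

module Defs where

open import Data.Nat using (ℕ; zero; suc; _*_; _<_; _≤_; NonZero)
open import Data.Nat.DivMod using (_%_)
open import Data.Nat.Divisibility using (_∣_)
open import Data.Nat.Primality using (Prime)
open import Data.Fin using (Fin; toℕ)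
open import Data.Fin.Subset using (Subset; _∈_; _∉_; ∣_∣)
open import Data.Product using (Σ; ∃; _×_)
open import Data.Sum using (_⊎_)
open import Relation.Nullary using (¬_)
open import Relation.Binary.PropositionalEquality using (_≡_; _≢_)

-- The cyclic group C_n is modelled as the additive group ℤ/nℤ with carrier Fin n;
-- the k-th power of x is k·x mod n.

IsPowerOf : (n : ℕ) → .{{NonZero n}} → Fin n → Fin n → Set
IsPowerOf n y x = ∃ λ (k : ℕ) → toℕ y ≡ (k * toℕ x) % n

Adj : (n : ℕ) → .{{NonZero n}} → Fin n → Fin n → Set
Adj n x y = x ≢ y × (IsPowerOf n x y ⊎ IsPowerOf n y x)

data Path (n : ℕ) .{{_ : NonZero n}} (X : Subset n) : Fin n → Fin n → Set where
  here  : ∀ {u} → u ∉ X → Path n X u u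
  step  : ∀ {u w v} → u ∉ X → Adj n u w → Path n X w v → Path n X u v

Disconnects : (n : ℕ) → .{{NonZero n}} → Subset n → Set
Disconnects n X = ∃ λ u → ∃ λ v → u ∉ X × v ∉ X × ¬ Path n X u v

MinimumCut : (n : ℕ) → .{{NonZero n}} → Subset n → Set
MinimumCut n X = Disconnects n X × (∀ (Y : Subset n) → Disconnects n Y → ∣ X ∣ ≤ ∣ Y ∣)

HasOrder : (n : ℕ) → .{{NonZero n}} → Fin n → ℕ → Set
HasOrder n x d = 0 < d × (d * toℕ x) % n ≡ 0
               × (∀ k → 0 < k → k < d → (k * toℕ x) % n ≢ 0)

TwoPrimeDivisors : ℕ → Set
TwoPrimeDivisors n = ∃ λ p → ∃ λ q → Prime p × Prime q × p ≢ q × (p ∣ n) × (q ∣ n)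

-- Elements of the same order d generate the same cyclic subgroup, so each is a power of the
-- other and they have the same neighbours in the power graph. If a minimum cut X contained one
-- element x of order d but missed another such y, every path avoiding X - x could be redirected
-- through y instead of x, so X - x would be a smaller cut.
module Submission where

open import Defs
open import Data.Nat using (ℕ; NonZero; suc; _+_; _*_; _/_; _<_; _≤_; _<?_; _≟_; ≢-nonZero; ≢-nonZero⁻¹; >-nonZero)
open import Data.Nat.Properties using (*-assoc; *-comm; *-identityˡ; ≤-antisym; ≮⇒≥; <⇒≱; n≢0⇒n>0; allUpTo?)
open import Data.Nat.DivMod using (_%_; %-distribˡ-*; m%n%n≡m%n; [m+kn]%n≡m%n; m<n⇒m%n≡m; m/n*n≡m; *-/-assoc)
open import Data.Nat.Divisibility using (_∣_; divides; m%n≡0⇒n∣m; n∣m⇒m%n≡0; *-monoʳ-∣; *-cancelˡ-∣; m*n∣o⇒m∣o/n; ∣⇒≤)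
open import Data.Nat.GCD using (gcd; gcd[m,n]∣m; gcd[m,n]∣n; gcd[m,n]≢0; n/gcd[m,n]≢0; gcd-GCD; module Bézout)
open import Data.Nat.Coprimality using (coprime-/gcd; coprime-divisor)
import Data.Nat.Coprimality as Coprime
open import Data.Fin using (Fin; toℕ)
open import Data.Fin.Properties using (toℕ<n; any?) renaming (_≟_ to _≟ᶠ_)
open import Data.Fin.Subset using (Subset; _∈_; _∉_; _-_; ⁅_⁆)
open import Data.Fin.Subset.Properties using (_∈?_; p─q⊆p; x∈p∧x≢y⇒x∈p-y; x∈p⇒∣p-x∣<∣p∣)
open import Data.Sum using (_⊎_; inj₁; inj₂)
open import Data.Product using (∃; _×_; _,_; proj₁; proj₂)
open import Data.Empty using (⊥-elim)
open import Relation.Nullary using (Dec; yes; no; ¬?)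
open import Relation.Nullary.Decidable using (_×-dec_; _→-dec_; map′; decidable-stable)
open import Relation.Binary.PropositionalEquality using (_≡_; _≢_; refl; sym; cong; subst; subst₂; module ≡-Reasoning)
open import Data.Nat.Solver using (module +-*-Solver)
open +-*-Solver using (solve; _:=_; _:+_; _:*_; con)
open ≡-Reasoning

m*[n%o]%o≡m*n%o : ∀ m n o .{{_ : NonZero o}} → (m * (n % o)) % o ≡ (m * n) % o
m*[n%o]%o≡m*n%o m n o = begin
  (m * (n % o)) % o           ≡⟨ %-distribˡ-* m (n % o) o ⟩
  ((m % o) * (n % o % o)) % o ≡⟨ cong (λ t → ((m % o) * t) % o) (m%n%n≡m%n n o) ⟩
  ((m % o) * (n % o)) % o     ≡⟨ %-distribˡ-* m n o ⟨
  (m * n) % o                 ∎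

-- Bézout's identity over ℕ comes in two sign patterns; in the second, -k is replaced by
-- k * (n - 1), which is congruent to it modulo n.
gcd%n≡multiple%n : ∀ a n .{{_ : NonZero n}} → ∃ λ k → gcd a n % n ≡ (k * a) % n
gcd%n≡multiple%n a n with Bézout.identity (gcd-GCD a n)
... | Bézout.+- k j eq = k , (begin
  gcd a n % n           ≡⟨ [m+kn]%n≡m%n (gcd a n) j n ⟨
  (gcd a n + j * n) % n ≡⟨ cong (_% n) eq ⟩
  (k * a) % n           ∎)
gcd%n≡multiple%n a n@(suc m) | Bézout.-+ k j eq = k * m , (begin
  g % n                       ≡⟨ [m+kn]%n≡m%n g (k * a) n ⟨
  (g + k * a * n) % n         ≡⟨ cong (_% n) (solve 4 (λ g k a m → g :+ k :* a :* (con 1 :+ m)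
                                                 := k :* m :* a :+ (g :+ k :* a)) refl g k a m) ⟩
  (k * m * a + (g + k * a)) % n ≡⟨ cong (λ t → (k * m * a + t) % n) eq ⟩
  (k * m * a + j * n) % n     ≡⟨ [m+kn]%n≡m%n (k * m * a) j n ⟩
  (k * m * a) % n             ∎)
  where g = gcd a n

module _ {n : ℕ} .{{_ : NonZero n}} where

  IsPowerOf-refl : ∀ {x : Fin n} → IsPowerOf n x x
  IsPowerOf-refl {x} = 1 , sym (begin
    (1 * toℕ x) % n ≡⟨ cong (_% n) (*-identityˡ (toℕ x)) ⟩
    toℕ x % n       ≡⟨ m<n⇒m%n≡m (toℕ<n x) ⟩
    toℕ x           ∎)

  IsPowerOf-trans : ∀ {x y z : Fin n} → IsPowerOf n x y → IsPowerOf n y z → IsPowerOf n x z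
  IsPowerOf-trans {x} {y} {z} (k , x≡ky) (j , y≡jz) = k * j , (begin
    toℕ x                         ≡⟨ x≡ky ⟩
    (k * toℕ y) % n               ≡⟨ cong (λ t → (k * t) % n) y≡jz ⟩
    (k * ((j * toℕ z) % n)) % n   ≡⟨ m*[n%o]%o≡m*n%o k (j * toℕ z) n ⟩
    (k * (j * toℕ z)) % n         ≡⟨ cong (_% n) (*-assoc k j (toℕ z)) ⟨
    (k * j * toℕ z) % n           ∎)

  gcd∣⇒IsPowerOf : ∀ {x y : Fin n} → gcd (toℕ y) n ∣ toℕ x → IsPowerOf n x y
  gcd∣⇒IsPowerOf {x} {y} (divides c x≡cg) with gcd%n≡multiple%n (toℕ y) n
  ... | k , g≡ky = c * k , (begin
    toℕ x                              ≡⟨ m<n⇒m%n≡m (toℕ<n x) ⟨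
    toℕ x % n                          ≡⟨ cong (_% n) x≡cg ⟩
    (c * g) % n                        ≡⟨ m*[n%o]%o≡m*n%o c g n ⟨
    (c * (g % n)) % n                  ≡⟨ cong (λ t → (c * t) % n) g≡ky ⟩
    (c * ((k * toℕ y) % n)) % n        ≡⟨ m*[n%o]%o≡m*n%o c (k * toℕ y) n ⟩
    (c * (k * toℕ y)) % n              ≡⟨ cong (_% n) (*-assoc c k (toℕ y)) ⟨
    (c * k * toℕ y) % n                ∎)
    where g = gcd (toℕ y) n

  HasOrder⇒d*gcd≡n : ∀ {y : Fin n} {d} → HasOrder n y d → d * gcd (toℕ y) n ≡ n
  HasOrder⇒d*gcd≡n {y} {d} (0<d , dy%n≡0 , minimal) = begin
    d * g     ≡⟨ cong (_* g) (≤-antisym d≤n/g n/g≤d) ⟩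
    n / g * g ≡⟨ n/g*g≡n ⟩
    n         ∎
    where
    Y = toℕ y
    g = gcd Y n
    instance
      g≢0 : NonZero g
      g≢0 = ≢-nonZero (gcd[m,n]≢0 Y n (inj₂ (≢-nonZero⁻¹ n)))
      d≢0 : NonZero d
      d≢0 = >-nonZero 0<d
    n/g*g≡n : n / g * g ≡ n
    n/g*g≡n = m/n*n≡m (gcd[m,n]∣n Y n)
    n∣[n/g]*Y : n ∣ n / g * Y
    n∣[n/g]*Y = subst (_∣ n / g * Y) n/g*g≡n (*-monoʳ-∣ (n / g) (gcd[m,n]∣m Y n))
    d≤n/g : d ≤ n / g
    d≤n/g = ≮⇒≥ λ n/g<d → minimal (n / g) (n≢0⇒n>0 (n/gcd[m,n]≢0 Y n)) n/g<d
                                  (n∣m⇒m%n≡0 _ n n∣[n/g]*Y)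
    n/g∣d*[Y/g] : n / g ∣ d * (Y / g)
    n/g∣d*[Y/g] = subst (n / g ∣_) (*-/-assoc d (gcd[m,n]∣m Y n))
      (m*n∣o⇒m∣o/n (n / g) g (subst (_∣ d * Y) (sym n/g*g≡n) (m%n≡0⇒n∣m _ n dy%n≡0)))
    n/g≤d : n / g ≤ d
    n/g≤d = ∣⇒≤ (coprime-divisor (Coprime.sym (coprime-/gcd Y n))
                                 (subst (n / g ∣_) (*-comm d (Y / g)) n/g∣d*[Y/g]))

  sameOrder⇒IsPowerOf : ∀ {x y : Fin n} {d} → HasOrder n x d → HasOrder n y d → IsPowerOf n x y
  sameOrder⇒IsPowerOf {x} {y} {d} (0<d , dx%n≡0 , _) y-ord = gcd∣⇒IsPowerOf gcd∣x
    where
    instance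
      d≢0 : NonZero d
      d≢0 = >-nonZero 0<d
    gcd∣x : gcd (toℕ y) n ∣ toℕ x
    gcd∣x = *-cancelˡ-∣ d (subst (_∣ d * toℕ x) (sym (HasOrder⇒d*gcd≡n y-ord))
                                 (m%n≡0⇒n∣m _ n dx%n≡0))

  hasOrder? : ∀ (x : Fin n) d → Dec (HasOrder n x d)
  hasOrder? x d = 0 <? d ×-dec (d * toℕ x) % n ≟ 0 ×-dec
    map′ {A = ∀ {k} → k < d → Nonzero k} (λ h k 0<k k<d → h k<d 0<k) (λ h k<d 0<k → h _ 0<k k<d)
         (allUpTo? nonzero? d)
    where
    Nonzero : ℕ → Set
    Nonzero k = 0 < k → (k * toℕ x) % n ≢ 0
    nonzero? : ∀ k → Dec (Nonzero k)
    nonzero? k = 0 <? k →-dec ¬? ((k * toℕ x) % n ≟ 0)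

  -- Endomaps of C_n preserving the power relation send each edge to an edge or to a single
  -- vertex, so they map paths to paths.
  Path-map : ∀ {X Y : Subset n} (f : Fin n → Fin n) →
             (∀ {z} → z ∉ X → f z ∉ Y) →
             (∀ {u w} → IsPowerOf n u w → IsPowerOf n (f u) (f w)) →
             ∀ {a b} → Path n X a b → Path n Y (f a) (f b)
  Path-map f f-avoids f-pow (here a∉X) = here (f-avoids a∉X)
  Path-map {Y = Y} f f-avoids f-pow {b = b} (step {u} {w} u∉X (_ , u~w) p) with f u ≟ᶠ f w
  ... | yes fu≡fw = subst (λ z → Path n Y z (f b)) (sym fu≡fw) (Path-map f f-avoids f-pow p)
  ... | no fu≢fw = step (f-avoids u∉X) (fu≢fw , pow u~w) (Path-map f f-avoids f-pow p)
    where
    pow : IsPowerOf n u w ⊎ IsPowerOf n w u → IsPowerOf n (f u) (f w) ⊎ IsPowerOf n (f w) (f u)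
    pow (inj₁ u^w) = inj₁ (f-pow u^w)
    pow (inj₂ w^u) = inj₂ (f-pow w^u)

  module _ (x y : Fin n) where

    redirect : Fin n → Fin n
    redirect z with z ≟ᶠ x
    ... | yes _ = y
    ... | no _  = z

    redirect-fixes : ∀ {z} → z ≢ x → redirect z ≡ z
    redirect-fixes {z} z≢x with z ≟ᶠ x
    ... | yes z≡x = ⊥-elim (z≢x z≡x)
    ... | no _    = refl

    redirect-avoids : ∀ {X : Subset n} → y ∉ X → ∀ {z} → z ∉ X - x → redirect z ∉ X
    redirect-avoids y∉X {z} z∉X-x with z ≟ᶠ x
    ... | yes _   = y∉X
    ... | no z≢x  = λ z∈X → z∉X-x (x∈p∧x≢y⇒x∈p-y z∈X z≢x)

    redirect-mutual : IsPowerOf n x y → IsPowerOf n y x →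
                      ∀ z → IsPowerOf n (redirect z) z × IsPowerOf n z (redirect z)
    redirect-mutual x^y y^x z with z ≟ᶠ x
    ... | yes refl = y^x , x^y
    ... | no _     = IsPowerOf-refl , IsPowerOf-refl

    redirect-pres-IsPowerOf : IsPowerOf n x y → IsPowerOf n y x →
                              ∀ {u w} → IsPowerOf n u w → IsPowerOf n (redirect u) (redirect w)
    redirect-pres-IsPowerOf x^y y^x {u} {w} u^w =
      IsPowerOf-trans (proj₁ (redirect-mutual x^y y^x u))
        (IsPowerOf-trans u^w (proj₂ (redirect-mutual x^y y^x w)))

  Disconnects-minus-twin : ∀ {X : Subset n} {x y} → Disconnects n X → x ∈ X → y ∉ X →
                           IsPowerOf n x y → IsPowerOf n y x → Disconnects n (X - x)
  Disconnects-minus-twin {X} {x} {y} (u , v , u∉X , v∉X , ¬u⇝v) x∈X y∉X x^y y^x =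
    u , v , ∉-minus u∉X , ∉-minus v∉X , λ u⇝v →
      ¬u⇝v (subst₂ (Path n X) (fixed u∉X) (fixed v∉X)
                  (Path-map (redirect x y) (redirect-avoids x y y∉X)
                            (redirect-pres-IsPowerOf x y x^y y^x) u⇝v))
    where
    ∉-minus : ∀ {z} → z ∉ X → z ∉ X - x
    ∉-minus z∉X z∈X-x = z∉X (p─q⊆p X ⁅ x ⁆ z∈X-x)
    fixed : ∀ {z} → z ∉ X → redirect x y z ≡ z
    fixed z∉X = redirect-fixes x y λ z≡x → z∉X (subst (_∈ X) (sym z≡x) x∈X)

lemma2p3 : (n : ℕ) → .{{_ : NonZero n}} → TwoPrimeDivisors n →
    (X : Subset n) → MinimumCut n X →
    (d : ℕ) → d ∣ n →
    (∀ (x : Fin n) → HasOrder n x d → x ∈ X) ⊎ (∀ (x : Fin n) → HasOrder n x d → x ∉ X)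
lemma2p3 n _ X (X-cut , X-minimum) d _ with any? (λ x → hasOrder? x d ×-dec x ∈? X)
... | no ∄x = inj₂ λ x x-ord x∈X → ∄x (x , x-ord , x∈X)
... | yes (x , x-ord , x∈X) = inj₁ λ y y-ord → decidable-stable (y ∈? X) λ y∉X →
  <⇒≱ (x∈p⇒∣p-x∣<∣p∣ x∈X)
      (X-minimum (X - x) (Disconnects-minus-twin X-cut x∈X y∉X
                            (sameOrder⇒IsPowerOf x-ord y-ord) (sameOrder⇒IsPowerOf y-ord x-ord)))
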